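{- Let $N,r,n$ be positive integers. Then $$ c_{N,n}^{(r)}=n!\,\det\left( \begin{array}{ccccc} D_r(1)&1&&&\\ D_r(2)&D_r(1)&&&\\ \vdots&\vdots&\ddots&1&\\ D_r(n-1)&D_r(n-2)&\cdots&D_r(1)&1\\ D_r(n)&D_r(n-1)&\cdots&D_r(2)&D_r(1) \end{array} \right), $$ i.e. the $n\times n$ matrix with $(i,j)$ entry $D_r(i-j+1)$ for $j\le i$, $1$ for $j=i+1$, and $0$ for $j\ge i+2$; here $$ D_r(e)=\sum_{\substack{i_1+\cdots+i_r=e\\ i_1,\dots,i_r\ge 0}}\frac{N^r}{(N+i_1)\cdots(N+i_r)}. $$
   Context: For positive integers $N$ and $r$, the (multiple) hypergeometric Cauchy numbers $c_{N,n}^{(r)}$ ($n\ge0$) are defined by the formal power series identity $$\frac{1}{\bigl({}_2F_1(1,N;N+1;-x)\bigr)^r}=\left(\frac{(-1)^{N-1}x^N/N}{\log(1+x)-\sum_{k=1}^{N-1}(-1)^{k-1}x^k/k}\right)^r=\sum_{n=0}^\infty c_{N,n}^{(r)}\frac{x^n}{n!},$$ where ${}_2F_1(a,b;c;z)=\sum_{n\ge0}\frac{(a)^{(n)}(b)^{(n)}}{(c)^{(n)}}\frac{z^n}{n!}$ is the Gauss hypergeometric function and $(x)^{(n)}=x(x+1)\cdots(x+n-1)$, $(x)^{(0)}=1$. -}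

module Defs where

open import Data.Nat as ℕ using (ℕ; zero; suc; _∸_; _!)
open import Data.Integer as ℤ using (+_)
open import Data.Rational using (ℚ; 0ℚ; 1ℚ; _+_; _*_; -_; _÷_; ≢-nonZero)
open import Data.Rational.Properties using (_≟_)
open import Data.Fin using (Fin; zero; suc; toℕ; punchIn)
open import Data.Vec using (Vec; []; _∷_)
open import Data.List using (List; []; _∷_; map; concatMap; upTo; foldr)
open import Relation.Nullary using (yes; no)

ℕtoℚ : ℕ → ℚ
ℕtoℚ n = + n Data.Rational./ 1

-- total division on ℚ (x / 0 := 0); only ever applied to nonzero divisors below
_//_ : ℚ → ℚ → ℚ
p // q with q ≟ 0ℚ
... | yes _ = 0ℚ
... | no q≢0 = _÷_ p q {{≢-nonZero q≢0}}

infixl 7 _//_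

_^ℚ_ : ℚ → ℕ → ℚ
x ^ℚ zero = 1ℚ
x ^ℚ suc n = x * (x ^ℚ n)

rising : ℚ → ℕ → ℚ
rising x zero = 1ℚ
rising x (suc n) = rising x n * (x + ℕtoℚ n)

sumℚ : List ℚ → ℚ
sumℚ = foldr _+_ 0ℚ

prodℚ : List ℚ → ℚ
prodℚ = foldr _*_ 1ℚ

Series : Set
Series = ℕ → ℚ

_⊛_ : Series → Series → Series
(f ⊛ g) n = sumℚ (map (λ k → f k * g (n ∸ k)) (upTo (suc n)))

powS : Series → ℕ → Series
powS f zero n = if0 n
  where
  if0 : ℕ → ℚ
  if0 zero = 1ℚ
  if0 (suc _) = 0ℚ
powS f (suc r) = f ⊛ powS f r

-- multiplicative inverse of a series f (meaningful when f 0 ≠ 0):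
-- g 0 = 1 / f 0,  g n = -(1 / f 0) * Σ_{k=1}^{n} f k * g (n - k)
-- invPrefix f n = [g (n-1), ..., g 0]  (reversed prefix)
private
  lookupRev : List ℚ → ℕ → ℚ
  lookupRev [] _ = 0ℚ
  lookupRev (x ∷ xs) zero = x
  lookupRev (x ∷ xs) (suc i) = lookupRev xs i

  len : List ℚ → ℕ
  len [] = 0
  len (_ ∷ xs) = suc (len xs)

nextInv : Series → List ℚ → ℚ
nextInv f [] = 1ℚ // f 0
nextInv f prev@(_ ∷ _) =
  - ((1ℚ // f 0) * sumℚ (map (λ k → f (suc k) * lookupRev prev k) (upTo n)))
  where
  n = len prev
  -- lookupRev prev k = g (n - 1 - k) = g (n - (k+1))

invPrefix : Series → ℕ → List ℚ
invPrefix f zero = []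
invPrefix f (suc n) = nextInv f (invPrefix f n) ∷ invPrefix f n

invS : Series → Series
invS f n = nextInv f (invPrefix f n)

hyp2F1 : ℚ → ℚ → ℚ → Series
hyp2F1 a b c n = (rising a n * rising b n) // (rising c n * ℕtoℚ (n !))

hypN : ℕ → Series
hypN N n = hyp2F1 1ℚ (ℕtoℚ N) (ℕtoℚ (suc N)) n * ((- 1ℚ) ^ℚ n)

-- hypergeometric Cauchy numbers: 1 / (2F1(1,N;N+1;-x))^r = Σ c_{N,n}^{(r)} x^n / n!
hypCauchy : (N r n : ℕ) → ℚ
hypCauchy N r n = ℕtoℚ (n !) * invS (powS (hypN N) r) n

compositions : (r e : ℕ) → List (Vec ℕ r)
compositions zero zero = [] ∷ []
compositions zero (suc e) = []
compositions (suc r) e =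
  concatMap (λ i → map (i ∷_) (compositions r (e ∸ i))) (upTo (suc e))

prodVec : ∀ {r} → Vec ℚ r → ℚ
prodVec [] = 1ℚ
prodVec (x ∷ xs) = x * prodVec xs

mapVec : ∀ {r} → (ℕ → ℚ) → Vec ℕ r → Vec ℚ r
mapVec f [] = []
mapVec f (x ∷ xs) = f x ∷ mapVec f xs

D : (N r e : ℕ) → ℚ
D N r e = sumℚ (map (λ is → ℕtoℚ N ^ℚ r // prodVec (mapVec (λ i → ℕtoℚ (N ℕ.+ i)) is))
                    (compositions r e))

det : ∀ n → (Fin n → Fin n → ℚ) → ℚ
det zero M = 1ℚ
det (suc n) M = sumℚ (map term (allF (suc n)))
  where
  allF : ∀ m → List (Fin m)
  allF zero = []
  allF (suc m) = zero ∷ map suc (allF m)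
  term : Fin (suc n) → ℚ
  term j = ((- 1ℚ) ^ℚ toℕ j) * M zero j * det n (λ i k → M (suc i) (punchIn j k))

-- the n×n Toeplitz–Hessenberg matrix of the theorem (0-indexed rows i, columns j):
-- entry D_r(i-j+1) if j ≤ i, 1 if j = i+1, 0 if j ≥ i+2
hessD : (N r n : ℕ) → Fin n → Fin n → ℚ
hessD N r n i j with toℕ j ℕ.≤? toℕ i
... | yes _ = D N r (suc (toℕ i) ∸ toℕ j)
... | no _ with toℕ j ℕ.≟ suc (toℕ i)
...   | yes _ = 1ℚ
...   | no _ = 0ℚ

-- Since ₂F₁(1,N;N+1;-x) = Σᵢ (-1)ⁱ N/(N+i) xⁱ, its r-th power is Σₑ (-1)ᵉ D_r(e) xᵉ.
-- The reciprocal g of a series Σₑ (-1)ᵉ dₑ xᵉ with d₀ = 1 satisfies g₀ = 1 and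
-- g_{n+1} = Σₖ (-1)ᵏ d_{k+1} g_{n-k}. Expanding the Toeplitz–Hessenberg determinant
-- along its first row, whose only nonzero entries are d₁ and 1, shows that the
-- determinants satisfy the same recurrence with the same initial value.
module Submission where

open import Defs
open import Data.Nat using (ℕ; _≤_; _!)
open import Data.Rational using (_*_)
open import Relation.Binary.PropositionalEquality using (_≡_)

open import Data.Nat as ℕ using (zero; suc; _<_; _∸_; NonZero; s≤s)
open import Data.Nat.Properties using (_!≢0)
import Data.Nat.Properties as ℕ
import Data.Nat.Coprimality as Coprimality
import Data.Integer as ℤ
import Data.Integer.Properties as ℤ
open import Data.Rational using (ℚ; 0ℚ; 1ℚ; _+_; -_; _-_; mkℚ; ≢-nonZero)
import Data.Rational.Properties as ℚ
open import Data.Rational.Solver using (module +-*-Solver)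
open import Data.Empty using (⊥-elim)
open import Data.Fin using (Fin; zero; suc; toℕ; punchIn)
open import Data.List using (List; []; _∷_; _++_; map; concatMap; upTo; applyUpTo; applyDownFrom)
open import Data.List.Properties using (map-cong; map-cong-local; map-∘; map-++; map-applyUpTo; ∷-injectiveˡ)
open import Data.List.Relation.Unary.All using (All; []; _∷_; universal)
open import Data.List.Relation.Unary.All.Properties using (map⁺; applyUpTo⁺₁)
open import Data.Vec using (Vec; _∷_)
open import Function using (_∘_; id)
open import Relation.Binary.PropositionalEquality using (_≢_; refl; sym; trans; cong; cong₂; module ≡-Reasoning)
open import Relation.Nullary using (Dec; yes; no)
open +-*-Solver
open ≡-Reasoning

-- total: 0ℚ ⁻¹ = 0ℚ, as for `_//_`
infix 10 _⁻¹
_⁻¹ : ℚ → ℚ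
p ⁻¹ = 1ℚ // p

//-≡-*⁻¹ : ∀ p q → p // q ≡ p * q ⁻¹
//-≡-*⁻¹ p q with q ℚ.≟ 0ℚ
... | yes _ = sym (ℚ.*-zeroʳ p)
... | no _ = cong (p *_) (sym (ℚ.*-identityˡ _))

*-inverseʳ : ∀ {p} → p ≢ 0ℚ → p * p ⁻¹ ≡ 1ℚ
*-inverseʳ {p} p≢0 with p ℚ.≟ 0ℚ
... | yes p≡0 = ⊥-elim (p≢0 p≡0)
... | no p≢0′ = trans (cong (p *_) (ℚ.*-identityˡ _)) (ℚ.*-inverseʳ p {{≢-nonZero p≢0′}})

p*q≡0⇒q≡0 : ∀ {p q} → p ≢ 0ℚ → p * q ≡ 0ℚ → q ≡ 0ℚ
p*q≡0⇒q≡0 {p} {q} p≢0 pq≡0 = begin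
  q                ≡⟨ sym (ℚ.*-identityˡ q) ⟩
  1ℚ * q           ≡⟨ cong (_* q) (sym (*-inverseʳ p≢0)) ⟩
  (p * p ⁻¹) * q   ≡⟨ solve 3 (λ p p⁻¹ q → (p :* p⁻¹) :* q := p⁻¹ :* (p :* q)) refl p (p ⁻¹) q ⟩
  p ⁻¹ * (p * q)   ≡⟨ cong (p ⁻¹ *_) pq≡0 ⟩
  p ⁻¹ * 0ℚ        ≡⟨ ℚ.*-zeroʳ (p ⁻¹) ⟩
  0ℚ               ∎

⁻¹-distrib-* : ∀ p q → (p * q) ⁻¹ ≡ p ⁻¹ * q ⁻¹
⁻¹-distrib-* p q = by-cases (p ℚ.≟ 0ℚ) (q ℚ.≟ 0ℚ)
  where
  by-cases : Dec (p ≡ 0ℚ) → Dec (q ≡ 0ℚ) → (p * q) ⁻¹ ≡ p ⁻¹ * q ⁻¹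
  by-cases (yes p≡0) _ = begin
    (p * q) ⁻¹      ≡⟨ cong (λ z → (z * q) ⁻¹) p≡0 ⟩
    (0ℚ * q) ⁻¹     ≡⟨ cong _⁻¹ (ℚ.*-zeroˡ q) ⟩
    0ℚ              ≡⟨ sym (ℚ.*-zeroˡ (q ⁻¹)) ⟩
    0ℚ ⁻¹ * q ⁻¹    ≡⟨ cong (λ z → z ⁻¹ * q ⁻¹) (sym p≡0) ⟩
    p ⁻¹ * q ⁻¹     ∎
  by-cases (no _) (yes q≡0) = begin
    (p * q) ⁻¹      ≡⟨ cong (λ z → (p * z) ⁻¹) q≡0 ⟩
    (p * 0ℚ) ⁻¹     ≡⟨ cong _⁻¹ (ℚ.*-zeroʳ p) ⟩
    0ℚ              ≡⟨ sym (ℚ.*-zeroʳ (p ⁻¹)) ⟩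
    p ⁻¹ * 0ℚ ⁻¹    ≡⟨ cong (λ z → p ⁻¹ * z ⁻¹) (sym q≡0) ⟩
    p ⁻¹ * q ⁻¹     ∎
  by-cases (no p≢0) (no q≢0) = begin
    (p * q) ⁻¹
      ≡⟨ sym (ℚ.*-identityʳ _) ⟩
    (p * q) ⁻¹ * 1ℚ
      ≡⟨ cong ((p * q) ⁻¹ *_) (sym (cong₂ _*_ (*-inverseʳ p≢0) (*-inverseʳ q≢0))) ⟩
    (p * q) ⁻¹ * ((p * p ⁻¹) * (q * q ⁻¹))
      ≡⟨ solve 5 (λ r p q p′ q′ → r :* ((p :* p′) :* (q :* q′)) := ((p :* q) :* r) :* (p′ :* q′)) refl
           ((p * q) ⁻¹) p q (p ⁻¹) (q ⁻¹) ⟩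
    ((p * q) * (p * q) ⁻¹) * (p ⁻¹ * q ⁻¹)
      ≡⟨ cong (_* (p ⁻¹ * q ⁻¹)) (*-inverseʳ (q≢0 ∘ p*q≡0⇒q≡0 p≢0)) ⟩
    1ℚ * (p ⁻¹ * q ⁻¹)
      ≡⟨ ℚ.*-identityˡ _ ⟩
    p ⁻¹ * q ⁻¹ ∎

ℕtoℚ-≡-mkℚ : ∀ n → ℕtoℚ n ≡ mkℚ (ℤ.+ n) 0 (Coprimality.sym (Coprimality.1-coprimeTo n))
ℕtoℚ-≡-mkℚ n = ℚ.normalize-coprime (Coprimality.sym (Coprimality.1-coprimeTo n))

ℕtoℚ-≢0 : ∀ n → .{{NonZero n}} → ℕtoℚ n ≢ 0ℚ
ℕtoℚ-≢0 (suc n) eq with trans (sym (ℕtoℚ-≡-mkℚ (suc n))) eq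
... | ()

ℕtoℚ-suc : ∀ n → ℕtoℚ (suc n) ≡ 1ℚ + ℕtoℚ n
ℕtoℚ-suc n = sym (begin
  1ℚ + ℕtoℚ n
    ≡⟨ cong (1ℚ +_) (ℕtoℚ-≡-mkℚ n) ⟩
  (ℤ.1ℤ ℤ.+ ℤ.+ n ℤ.* ℤ.1ℤ) Data.Rational./ 1
    ≡⟨ ℚ./-cong (cong (ℤ._+_ ℤ.1ℤ) (ℤ.*-identityʳ (ℤ.+ n))) refl ⟩
  ℕtoℚ (suc n) ∎)

ℕtoℚ-+ : ∀ m n → ℕtoℚ (m ℕ.+ n) ≡ ℕtoℚ m + ℕtoℚ n
ℕtoℚ-+ zero n = sym (ℚ.+-identityˡ (ℕtoℚ n))
ℕtoℚ-+ (suc m) n = begin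
  ℕtoℚ (suc (m ℕ.+ n))       ≡⟨ ℕtoℚ-suc (m ℕ.+ n) ⟩
  1ℚ + ℕtoℚ (m ℕ.+ n)        ≡⟨ cong (1ℚ +_) (ℕtoℚ-+ m n) ⟩
  1ℚ + (ℕtoℚ m + ℕtoℚ n)     ≡⟨ sym (ℚ.+-assoc 1ℚ (ℕtoℚ m) (ℕtoℚ n)) ⟩
  (1ℚ + ℕtoℚ m) + ℕtoℚ n     ≡⟨ cong (_+ ℕtoℚ n) (sym (ℕtoℚ-suc m)) ⟩
  ℕtoℚ (suc m) + ℕtoℚ n      ∎

ℕtoℚ-* : ∀ m n → ℕtoℚ (m ℕ.* n) ≡ ℕtoℚ m * ℕtoℚ n
ℕtoℚ-* zero n = sym (ℚ.*-zeroˡ (ℕtoℚ n))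
ℕtoℚ-* (suc m) n = begin
  ℕtoℚ (n ℕ.+ m ℕ.* n)          ≡⟨ ℕtoℚ-+ n (m ℕ.* n) ⟩
  ℕtoℚ n + ℕtoℚ (m ℕ.* n)       ≡⟨ cong (ℕtoℚ n +_) (ℕtoℚ-* m n) ⟩
  ℕtoℚ n + ℕtoℚ m * ℕtoℚ n      ≡⟨ solve 2 (λ m n → n :+ m :* n := (con 1ℚ :+ m) :* n) refl (ℕtoℚ m) (ℕtoℚ n) ⟩
  (1ℚ + ℕtoℚ m) * ℕtoℚ n        ≡⟨ cong (_* ℕtoℚ n) (sym (ℕtoℚ-suc m)) ⟩
  ℕtoℚ (suc m) * ℕtoℚ n         ∎

sumℚ-++ : ∀ xs ys → sumℚ (xs ++ ys) ≡ sumℚ xs + sumℚ ys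
sumℚ-++ [] ys = sym (ℚ.+-identityˡ (sumℚ ys))
sumℚ-++ (x ∷ xs) ys =
  trans (cong (x +_) (sumℚ-++ xs ys)) (sym (ℚ.+-assoc x (sumℚ xs) (sumℚ ys)))

sumℚ-concatMap : ∀ {A B : Set} (f : B → ℚ) (g : A → List B) xs →
  sumℚ (map f (concatMap g xs)) ≡ sumℚ (map (λ x → sumℚ (map f (g x))) xs)
sumℚ-concatMap f g [] = refl
sumℚ-concatMap f g (x ∷ xs) = begin
  sumℚ (map f (g x ++ concatMap g xs))                ≡⟨ cong sumℚ (map-++ f (g x) _) ⟩
  sumℚ (map f (g x) ++ map f (concatMap g xs))        ≡⟨ sumℚ-++ (map f (g x)) _ ⟩
  sumℚ (map f (g x)) + sumℚ (map f (concatMap g xs))  ≡⟨ cong (sumℚ (map f (g x)) +_) (sumℚ-concatMap f g xs) ⟩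
  sumℚ (map f (g x)) + sumℚ (map (λ x → sumℚ (map f (g x))) xs) ∎

sumℚ-*ˡ : ∀ {A : Set} c (f : A → ℚ) xs → sumℚ (map (λ x → c * f x) xs) ≡ c * sumℚ (map f xs)
sumℚ-*ˡ c f [] = sym (ℚ.*-zeroʳ c)
sumℚ-*ˡ c f (x ∷ xs) =
  trans (cong (c * f x +_) (sumℚ-*ˡ c f xs)) (sym (ℚ.*-distribˡ-+ c (f x) (sumℚ (map f xs))))

sumℚ-map-zero : ∀ {A : Set} {f : A → ℚ} {xs} → All (λ x → f x ≡ 0ℚ) xs → sumℚ (map f xs) ≡ 0ℚ
sumℚ-map-zero [] = refl
sumℚ-map-zero (fx≡0 ∷ fxs≡0) = cong₂ _+_ fx≡0 (sumℚ-map-zero fxs≡0)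

sgn : ℕ → ℚ
sgn e = (- 1ℚ) ^ℚ e

sgn-+ : ∀ a b → sgn (a ℕ.+ b) ≡ sgn a * sgn b
sgn-+ zero b = sym (ℚ.*-identityˡ (sgn b))
sgn-+ (suc a) b = trans (cong (- 1ℚ *_) (sgn-+ a b)) (sym (ℚ.*-assoc (- 1ℚ) (sgn a) (sgn b)))

weightedSum : (ℕ → ℚ) → List ℚ → ℚ
weightedSum c [] = 0ℚ
weightedSum c (x ∷ xs) = c 0 * x + weightedSum (c ∘ suc) xs

weightedSum-scale : ∀ a (c : ℕ → ℚ) {c′ : ℕ → ℚ} → (∀ k → c′ k ≡ a * c k) →
  ∀ xs → weightedSum c′ xs ≡ a * weightedSum c xs
weightedSum-scale a c c′≡ac [] = sym (ℚ.*-zeroʳ a)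
weightedSum-scale a c {c′} c′≡ac (x ∷ xs) = begin
  c′ 0 * x + weightedSum (c′ ∘ suc) xs
    ≡⟨ cong₂ (λ u v → u * x + v) (c′≡ac 0) (weightedSum-scale a (c ∘ suc) (c′≡ac ∘ suc) xs) ⟩
  a * c 0 * x + a * weightedSum (c ∘ suc) xs
    ≡⟨ solve 4 (λ a c x s → a :* c :* x :+ a :* s := a :* (c :* x :+ s)) refl a (c 0) x _ ⟩
  a * (c 0 * x + weightedSum (c ∘ suc) xs) ∎

powS-zero : ∀ f → f 0 ≡ 1ℚ → ∀ r → powS f r 0 ≡ 1ℚ
powS-zero f f₀≡1 zero = refl
powS-zero f f₀≡1 (suc r) = trans (ℚ.+-identityʳ _) (cong₂ _*_ f₀≡1 (powS-zero f f₀≡1 r))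

-- `nextInv` sums over `upTo` of a list length private to `Defs`; abstracting `applyUpTo`
-- keeps that stuck length from blocking unification.
private
  sum-shift : ∀ {ap : (ℕ → ℕ) → ℕ → List ℕ} → applyUpTo ≡ ap → ∀ (g : ℕ → ℚ) n →
    sumℚ (map g (ap (λ k → suc (suc k)) n)) ≡ sumℚ (map (g ∘ suc) (applyUpTo suc n))
  sum-shift refl g n = cong sumℚ (trans (map-applyUpTo _ g n) (sym (map-applyUpTo suc (g ∘ suc) n)))

  neg-1*-injective : ∀ {p q} → - (1ℚ * p) ≡ - (1ℚ * q) → p ≡ q
  neg-1*-injective {p} {q} eq =
    trans (sym (ℚ.*-identityˡ p)) (trans (ℚ.neg-injective eq) (ℚ.*-identityˡ q))

nextInv-∷ : ∀ f x xs → nextInv f (x ∷ xs) ≡ - (f 0 ⁻¹ * weightedSum (f ∘ suc) (x ∷ xs))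
nextInv-∷ f x [] = refl
nextInv-∷ f x (y ∷ ys) with applyUpTo {A = ℕ} in applyUpTo≡ap
... | ap = cong (λ s → - (f 0 ⁻¹ * (f 1 * x + s)))
                (trans (cong (f 2 * y +_) (sum-shift applyUpTo≡ap _ _)) (neg-1*-injective (nextInv-∷ f′ y ys)))
  where
  -- the tail of f behind a unit leading coefficient, so the induction hypothesis can be cancelled
  f′ : Series
  f′ zero = 1ℚ
  f′ (suc k) = f (suc (suc k))

invPrefix-≡-applyDownFrom : ∀ f n → invPrefix f n ≡ applyDownFrom (invS f) n
invPrefix-≡-applyDownFrom f zero = refl
invPrefix-≡-applyDownFrom f (suc n) = cong (invS f n ∷_) (invPrefix-≡-applyDownFrom f n)

invS-suc : ∀ f → f 0 ≡ 1ℚ → ∀ n →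
  invS f (suc n) ≡ - weightedSum (f ∘ suc) (applyDownFrom (invS f) (suc n))
invS-suc f f₀≡1 n = begin
  nextInv f (invS f n ∷ invPrefix f n)
    ≡⟨ nextInv-∷ f (invS f n) (invPrefix f n) ⟩
  - (f 0 ⁻¹ * weightedSum (f ∘ suc) (invS f n ∷ invPrefix f n))
    ≡⟨ cong₂ (λ c xs → - (c ⁻¹ * weightedSum (f ∘ suc) (invS f n ∷ xs)))
             f₀≡1 (invPrefix-≡-applyDownFrom f n) ⟩
  - (1ℚ * weightedSum (f ∘ suc) (applyDownFrom (invS f) (suc n)))
    ≡⟨ cong -_ (ℚ.*-identityˡ _) ⟩
  - weightedSum (f ∘ suc) (applyDownFrom (invS f) (suc n)) ∎

minor : ∀ {n} → (Fin (suc n) → Fin (suc n) → ℚ) → Fin (suc n) → Fin n → Fin n → ℚ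
minor M j i k = M (suc i) (punchIn j k)

-- `det` sums over a list of columns local to `Defs` whose length is a variable; abstracting
-- `map` exposes that list rigidly so it can be matched.
private
  sum-mapped-cong : ∀ {A : Set} {mp : (A → ℚ) → List A → List ℚ} → map ≡ mp →
    ∀ {f g : A → ℚ} → (∀ x → f x ≡ g x) → ∀ xs → sumℚ (mp f xs) ≡ sumℚ (mp g xs)
  sum-mapped-cong refl f≗g xs = cong sumℚ (map-cong f≗g xs)

  sum-mapped-zero : ∀ {A : Set} {mp : (A → ℚ) → List A → List ℚ} → map ≡ mp →
    ∀ {f : A → ℚ} {xs} → All (λ x → f x ≡ 0ℚ) xs → sumℚ (mp f xs) ≡ 0ℚ
  sum-mapped-zero refl = sumℚ-map-zero

det-cong : ∀ n {M M′ : Fin n → Fin n → ℚ} → (∀ i j → M i j ≡ M′ i j) → det n M ≡ det n M′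
det-cong zero _ = refl
det-cong (suc n) {M} {M′} M≗M′ with map {A = Fin (suc n)} {B = ℚ} in map≡mp
... | mp = cong₂ _+_ (term-cong zero) (sum-mapped-cong map≡mp term-cong _)
  where
  term-cong : ∀ j → sgn (toℕ j) * M zero j * det n (minor M j) ≡ sgn (toℕ j) * M′ zero j * det n (minor M′ j)
  term-cong j =
    cong₂ (λ a δ → sgn (toℕ j) * a * δ) (M≗M′ zero j) (det-cong n (λ i k → M≗M′ (suc i) (punchIn j k)))

det-1×1 : ∀ (M : Fin 1 → Fin 1 → ℚ) → det 1 M ≡ M zero zero
det-1×1 M = solve 1 (λ a → con 1ℚ :* a :* con 1ℚ :+ con 0ℚ := a) refl (M zero zero)

det-expand-row₀ : ∀ m (M : Fin (suc (suc m)) → Fin (suc (suc m)) → ℚ) →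
  (∀ j → M zero (suc (suc j)) ≡ 0ℚ) →
  det (suc (suc m)) M ≡
    M zero zero * det (suc m) (minor M zero) - M zero (suc zero) * det (suc m) (minor M (suc zero))
det-expand-row₀ m M row₀ with map {A = Fin (suc (suc m))} {B = ℚ} in map≡mp
... | mp = begin
  term zero + (term (suc zero) + sumℚ (mp term _))
    ≡⟨ cong (λ s → term zero + (term (suc zero) + s))
            (sum-mapped-zero map≡mp (map⁺ (map⁺ (universal term-zero _)))) ⟩
  term zero + (term (suc zero) + 0ℚ)
    ≡⟨ solve 4 (λ a δ b δ′ → con 1ℚ :* a :* δ :+ (con (- 1ℚ) :* con 1ℚ :* b :* δ′ :+ con 0ℚ)
                             := a :* δ :- b :* δ′) refl
         (M zero zero) (det (suc m) (minor M zero)) (M zero (suc zero)) (det (suc m) (minor M (suc zero))) ⟩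
  M zero zero * det (suc m) (minor M zero) - M zero (suc zero) * det (suc m) (minor M (suc zero)) ∎
  where
  term : Fin (suc (suc m)) → ℚ
  term j = sgn (toℕ j) * M zero j * det (suc m) (minor M j)
  term-zero : ∀ j → term (suc (suc j)) ≡ 0ℚ
  term-zero j =
    trans (cong (λ a → s * a * δ) (row₀ j)) (solve 2 (λ s δ → s :* con 0ℚ :* δ := con 0ℚ) refl s δ)
    where
    s δ : ℚ
    s = sgn (toℕ (suc (suc j)))
    δ = det (suc m) (minor M (suc (suc j)))

unitToeplitz : (ℕ → ℚ) → ℕ → ℕ → ℚ
unitToeplitz d zero zero = 1ℚ
unitToeplitz d zero (suc j) = 0ℚ
unitToeplitz d (suc i) zero = d (suc i)
unitToeplitz d (suc i) (suc j) = unitToeplitz d i j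

unitToeplitz-below : ∀ d i j → j < i → unitToeplitz d i j ≡ d (i ∸ j)
unitToeplitz-below d (suc i) zero _ = refl
unitToeplitz-below d (suc i) (suc j) (s≤s j<i) = unitToeplitz-below d i j j<i

unitToeplitz-diag : ∀ d i → unitToeplitz d i i ≡ 1ℚ
unitToeplitz-diag d zero = refl
unitToeplitz-diag d (suc i) = unitToeplitz-diag d i

unitToeplitz-above : ∀ d i j → i < j → unitToeplitz d i j ≡ 0ℚ
unitToeplitz-above d zero (suc j) _ = refl
unitToeplitz-above d (suc i) (suc j) (s≤s i<j) = unitToeplitz-above d i j i<j

hessenberg : (ℕ → ℚ) → ∀ n → Fin n → Fin n → ℚ
hessenberg d n i j = unitToeplitz d (suc (toℕ i)) (toℕ j)

hessDet : (ℕ → ℚ) → ℕ → ℚ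
hessDet d n = det n (hessenberg d n)

bordered : (ℕ → ℚ) → (ℕ → ℚ) → ∀ m → Fin (suc m) → Fin (suc m) → ℚ
bordered d u m i zero = u (toℕ i)
bordered d u m i (suc k) = unitToeplitz d (toℕ i) (toℕ k)

hessDet-≡-bordered : ∀ d m → hessDet d (suc m) ≡ det (suc m) (bordered d (d ∘ suc) m)
hessDet-≡-bordered d m = det-cong (suc m) entries
  where
  entries : ∀ i j → hessenberg d (suc m) i j ≡ bordered d (d ∘ suc) m i j
  entries i zero = refl
  entries i (suc k) = refl

bordered-expand : ∀ d u m →
  det (suc (suc m)) (bordered d u (suc m)) ≡ u 0 * hessDet d (suc m) - det (suc m) (bordered d (u ∘ suc) m)
bordered-expand d u m = begin
  det (suc (suc m)) (bordered d u (suc m))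
    ≡⟨ det-expand-row₀ m (bordered d u (suc m)) (λ _ → refl) ⟩
  u 0 * hessDet d (suc m) - 1ℚ * det (suc m) (minor (bordered d u (suc m)) (suc zero))
    ≡⟨ cong (λ z → u 0 * hessDet d (suc m) - z) (trans (ℚ.*-identityˡ _) (det-cong (suc m) entries)) ⟩
  u 0 * hessDet d (suc m) - det (suc m) (bordered d (u ∘ suc) m) ∎
  where
  entries : ∀ i k → minor (bordered d u (suc m)) (suc zero) i k ≡ bordered d (u ∘ suc) m i k
  entries i zero = refl
  entries i (suc k) = refl

bordered-≡-weightedSum : ∀ d u m →
  det (suc m) (bordered d u m) ≡ weightedSum (λ k → sgn k * u k) (applyDownFrom (hessDet d) (suc m))
bordered-≡-weightedSum d u zero =
  trans (det-1×1 (bordered d u 0)) (solve 1 (λ a → a := con 1ℚ :* a :* con 1ℚ :+ con 0ℚ) refl (u 0))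
bordered-≡-weightedSum d u (suc m) = begin
  det (suc (suc m)) (bordered d u (suc m))
    ≡⟨ bordered-expand d u m ⟩
  u 0 * h - det (suc m) (bordered d (u ∘ suc) m)
    ≡⟨ cong (λ z → u 0 * h - z) (bordered-≡-weightedSum d (u ∘ suc) m) ⟩
  u 0 * h - weightedSum (λ k → sgn k * u (suc k)) hs
    ≡⟨ solve 3 (λ a h w → a :* h :- w := con 1ℚ :* a :* h :+ con (- 1ℚ) :* w) refl (u 0) h _ ⟩
  1ℚ * u 0 * h + - 1ℚ * weightedSum (λ k → sgn k * u (suc k)) hs
    ≡⟨ cong (1ℚ * u 0 * h +_) (sym (weightedSum-scale (- 1ℚ) (λ k → sgn k * u (suc k)) alternate hs)) ⟩
  weightedSum (λ k → sgn k * u k) (applyDownFrom (hessDet d) (suc (suc m))) ∎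
  where
  h : ℚ
  h = hessDet d (suc m)
  hs : List ℚ
  hs = applyDownFrom (hessDet d) (suc m)
  alternate : ∀ k → sgn (suc k) * u (suc k) ≡ - 1ℚ * (sgn k * u (suc k))
  alternate k = ℚ.*-assoc (- 1ℚ) (sgn k) (u (suc k))

hessDet-suc : ∀ d m →
  hessDet d (suc m) ≡ weightedSum (λ k → sgn k * d (suc k)) (applyDownFrom (hessDet d) (suc m))
hessDet-suc d m = trans (hessDet-≡-bordered d m) (bordered-≡-weightedSum d (d ∘ suc) m)

invS-≡-hessDet : ∀ (f d : ℕ → ℚ) → f 0 ≡ 1ℚ → (∀ k → f (suc k) ≡ sgn (suc k) * d (suc k)) →
  ∀ n → invS f n ≡ hessDet d n
invS-≡-hessDet f d f₀≡1 f≡±d n = ∷-injectiveˡ (prefixes-agree (suc n))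
  where
  alternate : ∀ k → f (suc k) ≡ - 1ℚ * (sgn k * d (suc k))
  alternate k = trans (f≡±d k) (ℚ.*-assoc (- 1ℚ) (sgn k) (d (suc k)))

  next-agrees : ∀ n → applyDownFrom (invS f) n ≡ applyDownFrom (hessDet d) n → invS f n ≡ hessDet d n
  next-agrees zero _ = cong _⁻¹ f₀≡1
  next-agrees (suc m) prefix = begin
    invS f (suc m)                                      ≡⟨ invS-suc f f₀≡1 m ⟩
    - weightedSum (f ∘ suc) (applyDownFrom (invS f) (suc m))
                                                        ≡⟨ cong (λ xs → - weightedSum (f ∘ suc) xs) prefix ⟩
    - weightedSum (f ∘ suc) hs                          ≡⟨ cong -_ (weightedSum-scale (- 1ℚ) c alternate hs) ⟩
    - (- 1ℚ * weightedSum c hs)                         ≡⟨ solve 1 (λ w → :- (con (- 1ℚ) :* w) := w) refl _ ⟩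
    weightedSum c hs                                    ≡⟨ sym (hessDet-suc d m) ⟩
    hessDet d (suc m)                                   ∎
    where
    c : ℕ → ℚ
    c k = sgn k * d (suc k)
    hs : List ℚ
    hs = applyDownFrom (hessDet d) (suc m)

  prefixes-agree : ∀ n → applyDownFrom (invS f) n ≡ applyDownFrom (hessDet d) n
  prefixes-agree zero = refl
  prefixes-agree (suc n) = cong₂ _∷_ (next-agrees n (prefixes-agree n)) (prefixes-agree n)

rising-1 : ∀ i → rising 1ℚ i ≡ ℕtoℚ (i !)
rising-1 zero = refl
rising-1 (suc i) = begin
  rising 1ℚ i * (1ℚ + ℕtoℚ i)   ≡⟨ cong₂ _*_ (rising-1 i) (sym (ℕtoℚ-suc i)) ⟩
  ℕtoℚ (i !) * ℕtoℚ (suc i)     ≡⟨ ℚ.*-comm (ℕtoℚ (i !)) (ℕtoℚ (suc i)) ⟩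
  ℕtoℚ (suc i) * ℕtoℚ (i !)     ≡⟨ sym (ℕtoℚ-* (suc i) (i !)) ⟩
  ℕtoℚ (suc i !)                ∎

rising-ratio : ∀ x → (∀ k → x + ℕtoℚ k ≢ 0ℚ) →
  ∀ i → rising x i * rising (1ℚ + x) i ⁻¹ ≡ x * (x + ℕtoℚ i) ⁻¹
rising-ratio x x+k≢0 zero = begin
  1ℚ                              ≡⟨ sym (*-inverseʳ (x+k≢0 0)) ⟩
  (x + ℕtoℚ 0) * (x + ℕtoℚ 0) ⁻¹  ≡⟨ cong (_* (x + ℕtoℚ 0) ⁻¹) (ℚ.+-identityʳ x) ⟩
  x * (x + ℕtoℚ 0) ⁻¹             ∎
rising-ratio x x+k≢0 (suc i) = begin
  rising x i * y * (rising (1ℚ + x) i * z) ⁻¹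
    ≡⟨ cong (rising x i * y *_) (⁻¹-distrib-* (rising (1ℚ + x) i) z) ⟩
  rising x i * y * (rising (1ℚ + x) i ⁻¹ * z ⁻¹)
    ≡⟨ solve 4 (λ r y r′ z′ → r :* y :* (r′ :* z′) := r :* r′ :* y :* z′) refl
         (rising x i) y (rising (1ℚ + x) i ⁻¹) (z ⁻¹) ⟩
  rising x i * rising (1ℚ + x) i ⁻¹ * y * z ⁻¹
    ≡⟨ cong (λ t → t * y * z ⁻¹) (rising-ratio x x+k≢0 i) ⟩
  x * y ⁻¹ * y * z ⁻¹
    ≡⟨ solve 4 (λ x y′ y z′ → x :* y′ :* y :* z′ := x :* (y :* y′) :* z′) refl x (y ⁻¹) y (z ⁻¹) ⟩
  x * (y * y ⁻¹) * z ⁻¹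
    ≡⟨ cong (λ t → x * t * z ⁻¹) (*-inverseʳ (x+k≢0 i)) ⟩
  x * 1ℚ * z ⁻¹
    ≡⟨ cong₂ (λ a b → a * b ⁻¹) (ℚ.*-identityʳ x) z≡x+[1+i] ⟩
  x * (x + ℕtoℚ (suc i)) ⁻¹ ∎
  where
  y z : ℚ
  y = x + ℕtoℚ i
  z = 1ℚ + x + ℕtoℚ i
  z≡x+[1+i] : z ≡ x + ℕtoℚ (suc i)
  z≡x+[1+i] = trans (solve 2 (λ x n → con 1ℚ :+ x :+ n := x :+ (con 1ℚ :+ n)) refl x (ℕtoℚ i))
                    (cong (x +_) (sym (ℕtoℚ-suc i)))

N/[N+i] : ℕ → ℕ → ℚ
N/[N+i] N i = ℕtoℚ N * ℕtoℚ (N ℕ.+ i) ⁻¹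

hypN-≡ : ∀ N i → hypN (suc N) i ≡ sgn i * N/[N+i] (suc N) i
hypN-≡ N i = begin
  (rising 1ℚ i * rising x i) // (rising x′ i * i!) * sgn i
    ≡⟨ cong (_* sgn i) (//-≡-*⁻¹ (rising 1ℚ i * rising x i) (rising x′ i * i!)) ⟩
  rising 1ℚ i * rising x i * (rising x′ i * i!) ⁻¹ * sgn i
    ≡⟨ cong₂ (λ a b → a * rising x i * b * sgn i) (rising-1 i) (⁻¹-distrib-* (rising x′ i) i!) ⟩
  i! * rising x i * (rising x′ i ⁻¹ * i! ⁻¹) * sgn i
    ≡⟨ solve 5 (λ f r r′ f′ s → f :* r :* (r′ :* f′) :* s := s :* (r :* r′) :* (f :* f′)) refl
         i! (rising x i) (rising x′ i ⁻¹) (i! ⁻¹) (sgn i) ⟩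
  sgn i * (rising x i * rising x′ i ⁻¹) * (i! * i! ⁻¹)
    ≡⟨ cong₂ (λ a b → sgn i * (rising x i * rising a i ⁻¹) * b)
             (ℕtoℚ-suc (suc N)) (*-inverseʳ (ℕtoℚ-≢0 (i !) {{i !≢0}})) ⟩
  sgn i * (rising x i * rising (1ℚ + x) i ⁻¹) * 1ℚ
    ≡⟨ cong (λ a → sgn i * a * 1ℚ) (rising-ratio x x+k≢0 i) ⟩
  sgn i * (x * (x + ℕtoℚ i) ⁻¹) * 1ℚ
    ≡⟨ trans (ℚ.*-identityʳ _) (cong (λ y → sgn i * (x * y ⁻¹)) (sym (ℕtoℚ-+ (suc N) i))) ⟩
  sgn i * N/[N+i] (suc N) i ∎
  where
  x x′ i! : ℚ
  x = ℕtoℚ (suc N)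
  x′ = ℕtoℚ (suc (suc N))
  i! = ℕtoℚ (i !)
  x+k≢0 : ∀ k → x + ℕtoℚ k ≢ 0ℚ
  x+k≢0 k = ℕtoℚ-≢0 (suc N ℕ.+ k) ∘ trans (ℕtoℚ-+ (suc N) k)

D-suc : ∀ N r e → D N (suc r) e ≡ sumℚ (map (λ i → N/[N+i] N i * D N r (e ∸ i)) (upTo (suc e)))
D-suc N r e = begin
  sumℚ (map (term (suc r)) (concatMap prepend (upTo (suc e))))
    ≡⟨ sumℚ-concatMap (term (suc r)) prepend (upTo (suc e)) ⟩
  sumℚ (map (λ i → sumℚ (map (term (suc r)) (prepend i))) (upTo (suc e)))
    ≡⟨ cong sumℚ (map-cong factor (upTo (suc e))) ⟩
  sumℚ (map (λ i → N/[N+i] N i * D N r (e ∸ i)) (upTo (suc e))) ∎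
  where
  x : ℚ
  x = ℕtoℚ N
  term : ∀ r → Vec ℕ r → ℚ
  term r is = x ^ℚ r // prodVec (mapVec (λ i → ℕtoℚ (N ℕ.+ i)) is)
  prepend : ℕ → List (Vec ℕ (suc r))
  prepend i = map (i ∷_) (compositions r (e ∸ i))
  term-∷ : ∀ i is → term (suc r) (i ∷ is) ≡ N/[N+i] N i * term r is
  term-∷ i is = begin
    (x * x ^ℚ r) // (a * p)
      ≡⟨ //-≡-*⁻¹ (x * x ^ℚ r) (a * p) ⟩
    x * x ^ℚ r * (a * p) ⁻¹
      ≡⟨ cong (x * x ^ℚ r *_) (⁻¹-distrib-* a p) ⟩
    x * x ^ℚ r * (a ⁻¹ * p ⁻¹)
      ≡⟨ solve 4 (λ x y a′ p′ → x :* y :* (a′ :* p′) := x :* a′ :* (y :* p′)) refl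
           x (x ^ℚ r) (a ⁻¹) (p ⁻¹) ⟩
    x * a ⁻¹ * (x ^ℚ r * p ⁻¹)
      ≡⟨ cong (N/[N+i] N i *_) (sym (//-≡-*⁻¹ (x ^ℚ r) p)) ⟩
    N/[N+i] N i * term r is ∎
    where
    a p : ℚ
    a = ℕtoℚ (N ℕ.+ i)
    p = prodVec (mapVec (λ i → ℕtoℚ (N ℕ.+ i)) is)
  factor : ∀ i → sumℚ (map (term (suc r)) (prepend i)) ≡ N/[N+i] N i * D N r (e ∸ i)
  factor i = begin
    sumℚ (map (term (suc r)) (map (i ∷_) cs))          ≡⟨ cong sumℚ (sym (map-∘ cs)) ⟩
    sumℚ (map (term (suc r) ∘ (i ∷_)) cs)              ≡⟨ cong sumℚ (map-cong (term-∷ i) cs) ⟩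
    sumℚ (map (λ is → N/[N+i] N i * term r is) cs)     ≡⟨ sumℚ-*ˡ (N/[N+i] N i) (term r) cs ⟩
    N/[N+i] N i * D N r (e ∸ i)                        ∎
    where
    cs : List (Vec ℕ r)
    cs = compositions r (e ∸ i)

powS-hypN : ∀ N r e → powS (hypN (suc N)) r e ≡ sgn e * D (suc N) r e
powS-hypN N zero zero = refl
powS-hypN N zero (suc e) = sym (ℚ.*-zeroʳ (sgn (suc e)))
powS-hypN N (suc r) e = begin
  sumℚ (map (λ k → hypN (suc N) k * powS (hypN (suc N)) r (e ∸ k)) (upTo (suc e)))
    ≡⟨ cong sumℚ (map-cong-local (applyUpTo⁺₁ id (suc e) summand)) ⟩
  sumℚ (map (λ k → sgn e * (N/[N+i] (suc N) k * D (suc N) r (e ∸ k))) (upTo (suc e)))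
    ≡⟨ sumℚ-*ˡ (sgn e) (λ k → N/[N+i] (suc N) k * D (suc N) r (e ∸ k)) (upTo (suc e)) ⟩
  sgn e * sumℚ (map (λ k → N/[N+i] (suc N) k * D (suc N) r (e ∸ k)) (upTo (suc e)))
    ≡⟨ cong (sgn e *_) (sym (D-suc (suc N) r e)) ⟩
  sgn e * D (suc N) (suc r) e ∎
  where
  summand : ∀ {k} → k < suc e →
    hypN (suc N) k * powS (hypN (suc N)) r (e ∸ k) ≡ sgn e * (N/[N+i] (suc N) k * D (suc N) r (e ∸ k))
  summand {k} (s≤s k≤e) = begin
    hypN (suc N) k * powS (hypN (suc N)) r (e ∸ k)
      ≡⟨ cong₂ _*_ (hypN-≡ N k) (powS-hypN N r (e ∸ k)) ⟩
    sgn k * w * (sgn (e ∸ k) * d)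
      ≡⟨ solve 4 (λ s w s′ d → s :* w :* (s′ :* d) := s :* s′ :* (w :* d)) refl (sgn k) w (sgn (e ∸ k)) d ⟩
    sgn k * sgn (e ∸ k) * (w * d)
      ≡⟨ cong (_* (w * d)) (sym (sgn-+ k (e ∸ k))) ⟩
    sgn (k ℕ.+ (e ∸ k)) * (w * d)
      ≡⟨ cong (λ j → sgn j * (w * d)) (ℕ.m+[n∸m]≡n k≤e) ⟩
    sgn e * (w * d) ∎
    where
    w d : ℚ
    w = N/[N+i] (suc N) k
    d = D (suc N) r (e ∸ k)

hessenberg-≡-hessD : ∀ N r n i j → hessenberg (D N r) n i j ≡ hessD N r n i j
hessenberg-≡-hessD N r n i j with toℕ j ℕ.≤? toℕ i
... | yes j≤i = unitToeplitz-below (D N r) (suc (toℕ i)) (toℕ j) (s≤s j≤i)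
... | no j≰i with toℕ j ℕ.≟ suc (toℕ i)
...   | yes j≡1+i =
  trans (cong (unitToeplitz (D N r) (suc (toℕ i))) j≡1+i) (unitToeplitz-diag (D N r) (suc (toℕ i)))
...   | no j≢1+i =
  unitToeplitz-above (D N r) (suc (toℕ i)) (toℕ j) (ℕ.≤∧≢⇒< (ℕ.≰⇒> j≰i) (j≢1+i ∘ sym))

theorem2 : (N r n : ℕ) → 1 ≤ N → 1 ≤ r → 1 ≤ n →
    hypCauchy N r n ≡ ℕtoℚ (n !) * det n (hessD N r n)
theorem2 (suc N) r n _ _ _ = cong (ℕtoℚ (n !) *_) (begin
  invS (powS (hypN (suc N)) r) n
    ≡⟨ invS-≡-hessDet (powS (hypN (suc N)) r) (D (suc N) r)
                      (powS-zero (hypN (suc N)) refl r) (powS-hypN N r ∘ suc) n ⟩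
  hessDet (D (suc N) r) n
    ≡⟨ det-cong n (hessenberg-≡-hessD (suc N) r n) ⟩
  det n (hessD (suc N) r n) ∎)
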